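{- If $\alpha$ and $\beta$ are ordinals with $\alpha<\beta$, then $\operatorname{o.t.}(\alpha/\!\sim_F)\le\operatorname{o.t.}(\beta/\!\sim_F)$. Equivalently, writing $\phi(\gamma)=1\cdot_F\gamma=\gamma\cdot_F1=\operatorname{o.t.}(\gamma/\!\sim_F)$, we have $\phi(\alpha)\le\phi(\beta)$.
   Context: For a linear order $L$, $x\sim_F y$ iff only finitely many points lie between $x$ and $y$; $L/\!\sim_F$ is the ordered set of classes (which is well-ordered when $L$ is). $L\cdot_F M$ is the order type of the lexicographic product $LM$ modulo $\sim_F$; $\operatorname{o.t.}$ denotes order type (an ordinal for well-orders). -}

module Defs where

open import Level using (0ℓ)
open import Data.Product using (Σ; ∃; _×_; _,_)
open import Data.Sum using (_⊎_)
open import Data.List using (List)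
open import Data.List.Membership.Propositional using (_∈_)
open import Relation.Nullary using (¬_)
open import Relation.Binary using (Rel; IsStrictTotalOrder)
open import Relation.Binary.PropositionalEquality using (_≡_)
open import Induction.WellFounded using (WellFounded)

record Ordinal : Set₁ where
  field
    Carrier : Set
    _<_     : Rel Carrier 0ℓ
    isSTO   : IsStrictTotalOrder _≡_ _<_
    wf      : WellFounded _<_

-- An ordered set with a (setoid) equality; used to present quotient orders L/∼F
-- without quotient types: carrier = representatives, _≈_ = the equivalence, _≺_ = order on classes.
record OrdSetoid : Set₁ where
  field
    Carrier : Set
    _≈_     : Rel Carrier 0ℓ
    _≺_     : Rel Carrier 0ℓ

-- An order isomorphism of A onto an initial segment (downward closed subset) of B,
-- well defined on classes: this witnesses o.t.(A) ≤ o.t.(B).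
record InitialEmbedding (A B : OrdSetoid) : Set where
  module A = OrdSetoid A
  module B = OrdSetoid B
  field
    f         : A.Carrier → B.Carrier
    resp      : ∀ {x y} → x A.≈ y → f x B.≈ f y
    injective : ∀ {x y} → f x B.≈ f y → x A.≈ y
    mono      : ∀ {x y} → x A.≺ y → f x B.≺ f y
    downward  : ∀ x z → z B.≺ f x → ∃ λ y → f y B.≈ z

_≤ot_ : OrdSetoid → OrdSetoid → Set
A ≤ot B = InitialEmbedding A B

module _ (L : Ordinal) where
  open Ordinal L

  Between : Carrier → Carrier → Carrier → Set
  Between x y z = (x < z × z < y) ⊎ (y < z × z < x)

  _∼F_ : Rel Carrier 0ℓ
  x ∼F y = ∃ λ (l : List Carrier) → ∀ z → Between x y z → z ∈ l

  quotF : OrdSetoid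
  quotF = record
    { Carrier = Carrier
    ; _≈_ = _∼F_
    ; _≺_ = λ x y → (x < y) × ¬ (x ∼F y)
    }

_<ord_ : Ordinal → Ordinal → Set
α <ord β =
  Σ B.Carrier λ b → Σ (A.Carrier → B.Carrier) λ f →
    (∀ {x y} → x A.< y → f x B.< f y)
    × (∀ x → f x B.< b)
    × (∀ y → y B.< b → ∃ λ x → f x ≡ y)
  where
    module A = Ordinal α
    module B = Ordinal β

-- An isomorphism f of α onto a proper initial segment of β has convex image, so the points
-- strictly between x and y correspond bijectively to those between f x and f y. Hence f
-- preserves and reflects ∼F, and since its image is downward closed it induces an embedding
-- of α/∼F onto an initial segment of β/∼F.
module Submission where

open import Defs
open import Data.Product using (∃; _,_; proj₁; proj₂)
open import Data.Sum using (inj₁; inj₂)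
open import Data.List using (List; []; _∷_; _++_; map)
open import Data.List.Relation.Unary.Any using (here; there)
open import Data.List.Membership.Propositional using (_∈_)
open import Data.List.Membership.Propositional.Properties using (∈-map⁺; ∈-++⁺ˡ; ∈-++⁺ʳ)
open import Relation.Nullary using (yes; no; contradiction)
open import Relation.Binary using (IsStrictTotalOrder; tri<; tri≈; tri>)
open import Relation.Binary.PropositionalEquality using (_≡_; refl; sym; subst)

∼F-refl : (L : Ordinal) (x : Ordinal.Carrier L) → _∼F_ L x x
∼F-refl L x = [] , λ { z (inj₁ (x<z , z<x)) → contradiction z<x (asym x<z)
                     ; z (inj₂ (x<z , z<x)) → contradiction z<x (asym x<z) }
  where open IsStrictTotalOrder (Ordinal.isSTO L)

module DownwardClosedEmbedding
  (α β : Ordinal) (f : Ordinal.Carrier α → Ordinal.Carrier β)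
  (f-mono : ∀ {x y} → Ordinal._<_ α x y → Ordinal._<_ β (f x) (f y))
  (f-downward : ∀ x w → Ordinal._<_ β w (f x) → ∃ λ z → f z ≡ w)
  where

  module A = Ordinal α
  module B = Ordinal β
  module SA = IsStrictTotalOrder A.isSTO
  module SB = IsStrictTotalOrder B.isSTO

  f-reflects-< : ∀ {x y} → f x B.< f y → x A.< y
  f-reflects-< {x} {y} fx<fy with SA.compare x y
  ... | tri< x<y _ _ = x<y
  ... | tri≈ _ refl _ = contradiction fx<fy (SB.irrefl refl)
  ... | tri> _ _ y<x = contradiction (f-mono y<x) (SB.asym fx<fy)

  f-injective : ∀ {x y} → f x ≡ f y → x ≡ y
  f-injective {x} {y} fx≡fy with SA.compare x y
  ... | tri< x<y _ _ = contradiction (f-mono x<y) (SB.irrefl fx≡fy)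
  ... | tri≈ _ x≡y _ = x≡y
  ... | tri> _ _ y<x = contradiction (f-mono y<x) (SB.irrefl (sym fx≡fy))

  Between-preserved : ∀ {x y z} → Between α x y z → Between β (f x) (f y) (f z)
  Between-preserved (inj₁ (x<z , z<y)) = inj₁ (f-mono x<z , f-mono z<y)
  Between-preserved (inj₂ (y<z , z<x)) = inj₂ (f-mono y<z , f-mono z<x)

  Between-reflected : ∀ {x y z} → Between β (f x) (f y) (f z) → Between α x y z
  Between-reflected (inj₁ (p , q)) = inj₁ (f-reflects-< p , f-reflects-< q)
  Between-reflected (inj₂ (p , q)) = inj₂ (f-reflects-< p , f-reflects-< q)

  Between-image : ∀ {x y w} → Between β (f x) (f y) w → ∃ λ z → f z ≡ w
  Between-image {y = y} {w = w} (inj₁ (_ , w<fy)) = f-downward y w w<fy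
  Between-image {x = x} {w = w} (inj₂ (_ , w<fx)) = f-downward x w w<fx

  preimageBelow : A.Carrier → List B.Carrier → List A.Carrier
  preimageBelow u [] = []
  preimageBelow u (w ∷ ws) with w SB.<? f u
  ... | yes w<fu = proj₁ (f-downward u w w<fu) ∷ preimageBelow u ws
  ... | no _     = preimageBelow u ws

  ∈-preimageBelow : ∀ {u z} l → z A.< u → f z ∈ l → z ∈ preimageBelow u l
  ∈-preimageBelow {u} {z} (.(f z) ∷ ws) z<u (here refl) with f z SB.<? f u
  ... | yes fz<fu = here (f-injective (sym (proj₂ (f-downward u (f z) fz<fu))))
  ... | no fz≮fu  = contradiction (f-mono z<u) fz≮fu
  ∈-preimageBelow {u} (w ∷ ws) z<u (there z∈ws) with w SB.<? f u
  ... | yes _ = there (∈-preimageBelow ws z<u z∈ws)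
  ... | no _  = ∈-preimageBelow ws z<u z∈ws

  ∼F-preserved : ∀ {x y} → _∼F_ α x y → _∼F_ β (f x) (f y)
  ∼F-preserved {x} {y} (l , covers) = map f l , λ w between →
    let (z , fz≡w) = Between-image between
        z-between = Between-reflected (subst (Between β (f x) (f y)) (sym fz≡w) between)
    in subst (_∈ map f l) fz≡w (∈-map⁺ f (covers z z-between))

  ∼F-reflected : ∀ {x y} → _∼F_ β (f x) (f y) → _∼F_ α x y
  ∼F-reflected {x} {y} (l , covers) = preimageBelow y l ++ preimageBelow x l , λ where
    z between@(inj₁ (_ , z<y)) →
      ∈-++⁺ˡ (∈-preimageBelow l z<y (covers (f z) (Between-preserved between)))
    z between@(inj₂ (_ , z<x)) →
      ∈-++⁺ʳ (preimageBelow y l) (∈-preimageBelow l z<x (covers (f z) (Between-preserved between)))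

  quotF-≤ot : quotF α ≤ot quotF β
  quotF-≤ot = record
    { f         = f
    ; resp      = ∼F-preserved
    ; injective = ∼F-reflected
    ; mono      = λ (x<y , x≁y) → f-mono x<y , λ fx∼fy → x≁y (∼F-reflected fx∼fy)
    ; downward  = λ x w (w<fx , _) →
        let (z , fz≡w) = f-downward x w w<fx
        in z , subst (_∼F_ β (f z)) fz≡w (∼F-refl β (f z))
    }

mainTheorem16 : (α β : Ordinal) → α <ord β → quotF α ≤ot quotF β
mainTheorem16 α β (b , f , f-mono , f<b , onto-below-b) =
  DownwardClosedEmbedding.quotF-≤ot α β f f-mono
    (λ x w w<fx → onto-below-b w (IsStrictTotalOrder.trans (Ordinal.isSTO β) w<fx (f<b x)))
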